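{- Let $m$ and $n$ be non-negative integers. Then \[ \begin{split} \sum_{k = 1}^n k^m w^* _k &= -\delta_{m,0}a - n^m \frac{w^* _{n + 2} }{q} + \frac{v_{m + 1} }{2q^{m + 1} }\sum_{j = 0}^m A(m,j)w^* _j + \frac{u_{m + 1} }{2q^{m + 1} }\sum_{j = 0}^m A(m,j)(w^* _{j + 1} - qw^* _{j - 1} )\\ &\quad- \sum_{s = 1}^m n^{m - s} \binom ms\frac{v_{n + s + 1} }{2q^{s + 1} }\sum_{j = 1}^s A(s,j)w^* _j - \sum_{s = 1}^m n^{m - s} \binom ms\frac{u_{n + s + 1} }{2q^{s + 1} }\sum_{j = 1}^s A(s,j)(w^* _{j + 1} - qw^* _{j - 1} ). \end{split} \]
   Context: Let $a,b,q$ be complex numbers with $q\ne0$. Define $(w^*_j)=(w^*_j(a,b;q))$ by $w^*_0=a$, $w^*_1=b$, $w^*_j=w^*_{j-1}-qw^*_{j-2}$ for $j\ge2$, extended to negative indices by $w^*_{ -j}=(w^*_{ -j+1}-w^*_{ -j+2})/q$. Let $(u_j)=(w^*_j(0,1;q))$ and $(v_j)=(w^*_j(2,1;q))$. $\delta_{m,0}$ is the Kronecker delta. The Eulerian numbers are $A(i,j)=\sum_{t=0}^j(-1)^t\binom{i+1}{t}(j-t)^i$ for non-negative integers $i,j$, with $0^0=1$. Empty sums are $0$. -}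

module Defs where

open import Level using (Level; _⊔_) renaming (suc to lsuc)
open import Data.Nat as ℕ using (ℕ; zero; suc; _∸_)
open import Data.Nat.Combinatorics using (_C_)
open import Data.Integer as ℤ using (ℤ; +_; -[1+_])
open import Data.Product using (_×_; _,_; proj₁; proj₂)
open import Relation.Nullary using (¬_)
open import Algebra.Bundles using (CommutativeRing)

sumℤ≤ : (ℕ → ℤ) → ℕ → ℤ
sumℤ≤ f zero    = f zero
sumℤ≤ f (suc j) = sumℤ≤ f j ℤ.+ f (suc j)

-- Eulerian numbers A(i,j) = Σ_{t=0}^{j} (-1)^t C(i+1,t) (j-t)^i   (0^0 = 1 in ℕ._^_)
Eulerian : ℕ → ℕ → ℤ
Eulerian i j = sumℤ≤ (λ t → (ℤ.- ℤ.1ℤ) ℤ.^ t ℤ.* (+ (suc i C t)) ℤ.* (+ ((j ∸ t) ℕ.^ i))) j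

-- A field of characteristic zero (stand-in for ℂ).
-- _⁻¹ is total; it is a two-sided inverse on nonzero elements.
-- canonical map ℕ → R
ringFromℕ : ∀ {c ℓ} (R : CommutativeRing c ℓ) → ℕ → CommutativeRing.Carrier R
ringFromℕ R zero    = CommutativeRing.0# R
ringFromℕ R (suc n) = CommutativeRing._+_ R (CommutativeRing.1# R) (ringFromℕ R n)

record Char0Field (c ℓ : Level) : Set (lsuc (c ⊔ ℓ)) where
  field
    commutativeRing : CommutativeRing c ℓ
  open CommutativeRing commutativeRing public
  fromℕ : ℕ → Carrier
  fromℕ = ringFromℕ commutativeRing
  field
    _⁻¹      : Carrier → Carrier
    ⁻¹-inverse : ∀ x → ¬ (x ≈ 0#) → x * (x ⁻¹) ≈ 1#
    char0    : ∀ n → ¬ (ringFromℕ commutativeRing (suc n) ≈ 0#)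

module FieldDefs {c ℓ : Level} (F : Char0Field c ℓ) where
  open Char0Field F

  fromℤ : ℤ → Carrier
  fromℤ (+ n)      = fromℕ n
  fromℤ -[1+ n ]   = - fromℕ (suc n)

  pow : Carrier → ℕ → Carrier
  pow x zero    = 1#
  pow x (suc n) = x * pow x n

  _÷_ : Carrier → Carrier → Carrier
  x ÷ y = x * (y ⁻¹)

  δ₀ : ℕ → Carrier
  δ₀ zero    = 1#
  δ₀ (suc _) = 0#

  -- Σ_{k=lo}^{hi} f k  (empty, i.e. 0#, when hi < lo)
  Σ[_⋯_] : ℕ → ℕ → (ℕ → Carrier) → Carrier
  Σ[ lo ⋯ hi ] f = go (suc hi ∸ lo)
    where
      go : ℕ → Carrier
      go zero    = 0#
      go (suc k) = go k + f (lo ℕ.+ k)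

  module _ (a b q : Carrier) where
    wPos : ℕ → Carrier × Carrier
    wPos zero    = a , b
    wPos (suc k) = proj₂ (wPos k) , (proj₂ (wPos k) - q * proj₁ (wPos k))

    -- (w*_{-k} , w*_{-k+1}) using w*_{-j} = (w*_{-j+1} - w*_{-j+2})/q
    wNeg : ℕ → Carrier × Carrier
    wNeg zero    = a , b
    wNeg (suc k) = ((proj₁ (wNeg k) - proj₂ (wNeg k)) ÷ q) , proj₁ (wNeg k)

    w* : ℤ → Carrier
    w* (+ n)      = proj₁ (wPos n)
    w* -[1+ n ]   = proj₁ (wNeg (suc n))

  u : Carrier → ℤ → Carrier
  u q = w* 0# 1# q

  v : Carrier → ℤ → Carrier
  v q = w* (1# + 1#) 1# q

-- Write y k for w*_k. A finitely supported sequence f, read as the polynomial Σ f_j xʲ in the shift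
-- operator, acts on y by k ↦ Σ_j f_j y_{k+j}; since y_{k+1} - y_{k+2} = q y_k, multiplying f by 1 - x
-- and moving one step to the right multiplies the result by q. The Eulerian numbers A(s,j) are the
-- coefficients of (1 - x)^{s+1} Σ_k kˢ xᵏ, a polynomial of degree s; likewise (1 - x)^{m+1} Σ_k (n + k)^m xᵏ
-- has degree m, and acting with it at m + 1 + n gives R(n) with R(n) - R(n + 1) = q^{m+1} n^m y_n.
-- Telescoping gives q^{m+1} Σ_{k<n} k^m y_k = R(0) - R(n), and expanding (n + k)^m binomially writes R(n)
-- through the sums Σ_j A(s,j) y_{s+1+n+j}, which the Lucas-type identity
-- 2 w*_{K+j} = v_K w*_j + u_K (w*_{j+1} - q w*_{j-1}) turns into the terms of the statement.

module Submission where

open import Defs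
open import Data.Nat as ℕ using (ℕ; zero; suc; _∸_; _≤_; _<_; z≤n; s≤s)
import Data.Nat.Properties as ℕ
open import Data.Nat.Combinatorics using (_C_; nCn≡1; nCk+nC[k+1]≡[n+1]C[k+1])
open import Data.Integer as ℤ using (ℤ; +_; -[1+_]; _⊖_)
import Data.Integer.Properties as ℤ
open import Data.Sign as Sign using (Sign)
open import Data.Fin using (toℕ)
open import Data.Sum using (inj₁; inj₂)
open import Data.Maybe using (just; nothing)
open import Algebra.Bundles using (CommutativeRing)
open import Relation.Binary.PropositionalEquality as ≡ using (_≡_)
open import Algebra.Solver.Ring.AlmostCommutativeRing using (_-Raw-AlmostCommutative⟶_; fromCommutativeRing)
open import Relation.Binary.Definitions using (WeaklyDecidable)
open import Relation.Nullary using (¬_; yes; no)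
import Algebra.Properties.Semiring.Binomial

module RingBasics {c ℓ} (R : CommutativeRing c ℓ) where
  open CommutativeRing R public hiding (zero)
  open import Algebra.Properties.Ring ring public
  open import Algebra.Properties.Semiring.Exp semiring public
  open import Algebra.Properties.Semiring.Mult semiring public
  open import Algebra.Properties.CommutativeSemigroup *-commutativeSemigroup public
    using () renaming (interchange to *-interchange)
  open import Relation.Binary.Reasoning.Setoid setoid public

  fromℕ : ℕ → Carrier
  fromℕ = ringFromℕ R

  fromℕ≈×1# : ∀ n → fromℕ n ≈ n × 1#
  fromℕ≈×1# zero    = refl
  fromℕ≈×1# (suc n) = +-congˡ (fromℕ≈×1# n)

  fromℕ-+ : ∀ m n → fromℕ (m ℕ.+ n) ≈ fromℕ m + fromℕ n
  fromℕ-+ m n = begin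
    fromℕ (m ℕ.+ n)       ≈⟨ fromℕ≈×1# (m ℕ.+ n) ⟩
    (m ℕ.+ n) × 1#        ≈⟨ ×-homo-+ 1# m n ⟩
    m × 1# + n × 1#       ≈⟨ +-cong (fromℕ≈×1# m) (fromℕ≈×1# n) ⟨
    fromℕ m + fromℕ n     ∎

  fromℕ-* : ∀ m n → fromℕ (m ℕ.* n) ≈ fromℕ m * fromℕ n
  fromℕ-* m n = begin
    fromℕ (m ℕ.* n)       ≈⟨ fromℕ≈×1# (m ℕ.* n) ⟩
    (m ℕ.* n) × 1#        ≈⟨ ×1-homo-* m n ⟩
    m × 1# * n × 1#       ≈⟨ *-cong (fromℕ≈×1# m) (fromℕ≈×1# n) ⟨
    fromℕ m * fromℕ n     ∎

  fromℕ-^ : ∀ m n → fromℕ (m ℕ.^ n) ≈ fromℕ m ^ n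
  fromℕ-^ m zero    = +-identityʳ 1#
  fromℕ-^ m (suc n) = trans (fromℕ-* m (m ℕ.^ n)) (*-congˡ (fromℕ-^ m n))

  fromℕ-×-* : ∀ n x → n × x ≈ fromℕ n * x
  fromℕ-×-* n x = begin
    n × x          ≈⟨ ×-congʳ n (*-identityˡ x) ⟨
    n × (1# * x)   ≈⟨ ×-assoc-* n 1# x ⟨
    n × 1# * x     ≈⟨ *-congʳ (fromℕ≈×1# n) ⟨
    fromℕ n * x    ∎

  ^-inverse : ∀ {x z} → x * z ≈ 1# → ∀ k → x ^ k * z ^ k ≈ 1#
  ^-inverse xz≈1 zero    = *-identityˡ 1#
  ^-inverse xz≈1 (suc k) = trans (*-interchange _ _ _ _) (trans (*-cong xz≈1 (^-inverse xz≈1 k)) (*-identityˡ 1#))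

  ^-cancel : ∀ {x z} → x * z ≈ 1# → ∀ {i j} → i ≤ j → x ^ (j ∸ i) * z ^ j ≈ z ^ i
  ^-cancel {x} {z} xz≈1 {i} {j} i≤j = begin
    x ^ (j ∸ i) * z ^ j                     ≈⟨ *-congˡ (^-congʳ z (ℕ.m∸n+n≡m i≤j)) ⟨
    x ^ (j ∸ i) * z ^ (j ∸ i ℕ.+ i)         ≈⟨ *-congˡ (^-homo-* z (j ∸ i) i) ⟩
    x ^ (j ∸ i) * (z ^ (j ∸ i) * z ^ i)     ≈⟨ *-assoc _ _ _ ⟨
    (x ^ (j ∸ i) * z ^ (j ∸ i)) * z ^ i     ≈⟨ trans (*-congʳ (^-inverse xz≈1 (j ∸ i))) (*-identityˡ _) ⟩
    z ^ i                                   ∎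

  fromℤ : ℤ → Carrier
  fromℤ (+ n)    = fromℕ n
  fromℤ -[1+ n ] = - fromℕ (suc n)

  fromℤ-⊖ : ∀ m n → fromℤ (m ⊖ n) ≈ fromℕ m - fromℕ n
  fromℤ-⊖ m       zero    = sym (trans (+-congˡ -0#≈0#) (+-identityʳ _))
  fromℤ-⊖ zero    (suc n) = sym (+-identityˡ _)
  fromℤ-⊖ (suc m) (suc n) = begin
    fromℤ (suc m ⊖ suc n)                  ≡⟨ ≡.cong fromℤ (ℤ.[1+m]⊖[1+n]≡m⊖n m n) ⟩
    fromℤ (m ⊖ n)                          ≈⟨ fromℤ-⊖ m n ⟩
    fromℕ m - fromℕ n                      ≈⟨ +-identityˡ _ ⟨
    0# + (fromℕ m - fromℕ n)               ≈⟨ +-congʳ (-‿inverseʳ 1#) ⟨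
    (1# - 1#) + (fromℕ m - fromℕ n)        ≈⟨ +-assoc _ _ _ ⟩
    1# + (- 1# + (fromℕ m - fromℕ n))      ≈⟨ +-congˡ (trans (sym (+-assoc _ _ _)) (+-congʳ (+-comm _ _))) ⟩
    1# + ((fromℕ m - 1#) - fromℕ n)        ≈⟨ +-congˡ (trans (+-assoc _ _ _) (+-congˡ (-‿+-comm 1# (fromℕ n)))) ⟩
    1# + (fromℕ m - (1# + fromℕ n))        ≈⟨ +-assoc _ _ _ ⟨
    (1# + fromℕ m) - (1# + fromℕ n)        ∎

  fromℤ-+ : ∀ i j → fromℤ (i ℤ.+ j) ≈ fromℤ i + fromℤ j
  fromℤ-+ (+ m)    (+ n)    = fromℕ-+ m n
  fromℤ-+ (+ m)    -[1+ n ] = fromℤ-⊖ m (suc n)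
  fromℤ-+ -[1+ m ] (+ n)    = trans (fromℤ-⊖ n (suc m)) (+-comm _ _)
  fromℤ-+ -[1+ m ] -[1+ n ] = begin
    - fromℕ (suc (suc (m ℕ.+ n)))      ≡⟨ ≡.cong (λ k → - fromℕ (suc k)) (ℕ.+-suc m n) ⟨
    - fromℕ (suc m ℕ.+ suc n)          ≈⟨ -‿cong (fromℕ-+ (suc m) (suc n)) ⟩
    - (fromℕ (suc m) + fromℕ (suc n))  ≈⟨ -‿+-comm _ _ ⟨
    - fromℕ (suc m) - fromℕ (suc n)    ∎

  fromℤ-neg : ∀ i → fromℤ (ℤ.- i) ≈ - fromℤ i
  fromℤ-neg (+ zero)    = sym -0#≈0#
  fromℤ-neg (+ suc n)   = refl
  fromℤ-neg -[1+ n ]    = sym (-‿involutive _)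

  fromSign : Sign → Carrier
  fromSign Sign.+ = 1#
  fromSign Sign.- = - 1#

  fromSign-* : ∀ s t → fromSign (s Sign.* t) ≈ fromSign s * fromSign t
  fromSign-* Sign.+ t      = sym (*-identityˡ _)
  fromSign-* Sign.- Sign.+ = sym (*-identityʳ _)
  fromSign-* Sign.- Sign.- = sym (trans (-1*x≈-x _) (-‿involutive _))

  fromℤ-◃ : ∀ s n → fromℤ (s ℤ.◃ n) ≈ fromSign s * fromℕ n
  fromℤ-◃ s      zero    = sym (zeroʳ _)
  fromℤ-◃ Sign.+ (suc n) = sym (*-identityˡ _)
  fromℤ-◃ Sign.- (suc n) = sym (-1*x≈-x _)

  fromℤ≈sign*abs : ∀ i → fromℤ i ≈ fromSign (ℤ.sign i) * fromℕ ℤ.∣ i ∣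
  fromℤ≈sign*abs i = trans (reflexive (≡.cong fromℤ (≡.sym (ℤ.◃-inverse i)))) (fromℤ-◃ (ℤ.sign i) ℤ.∣ i ∣)

  fromℤ-* : ∀ i j → fromℤ (i ℤ.* j) ≈ fromℤ i * fromℤ j
  fromℤ-* i j = begin
    fromℤ (i ℤ.* j)                                                  ≈⟨ fromℤ-◃ (ℤ.sign i Sign.* ℤ.sign j) (ℤ.∣ i ∣ ℕ.* ℤ.∣ j ∣) ⟩
    fromSign (ℤ.sign i Sign.* ℤ.sign j) * fromℕ (ℤ.∣ i ∣ ℕ.* ℤ.∣ j ∣)
      ≈⟨ *-cong (fromSign-* (ℤ.sign i) (ℤ.sign j)) (fromℕ-* ℤ.∣ i ∣ ℤ.∣ j ∣) ⟩
    (fromSign (ℤ.sign i) * fromSign (ℤ.sign j)) * (fromℕ ℤ.∣ i ∣ * fromℕ ℤ.∣ j ∣) ≈⟨ *-interchange _ _ _ _ ⟩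
    (fromSign (ℤ.sign i) * fromℕ ℤ.∣ i ∣) * (fromSign (ℤ.sign j) * fromℕ ℤ.∣ j ∣) ≈⟨ *-cong (fromℤ≈sign*abs i) (fromℤ≈sign*abs j) ⟨
    fromℤ i * fromℤ j                                                ∎

  fromℤ-^ : ∀ i n → fromℤ (i ℤ.^ n) ≈ fromℤ i ^ n
  fromℤ-^ i zero    = +-identityʳ 1#
  fromℤ-^ i (suc n) = trans (fromℤ-* i (i ℤ.^ n)) (*-congˡ (fromℤ-^ i n))

  fromℤ-homomorphism : ℤ.+-*-rawRing -Raw-AlmostCommutative⟶ fromCommutativeRing R
  fromℤ-homomorphism = record
    { ⟦_⟧    = fromℤ
    ; +-homo = fromℤ-+
    ; *-homo = fromℤ-*
    ; -‿homo = fromℤ-neg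
    ; 0-homo = refl
    ; 1-homo = +-identityʳ 1#
    }

  coefficientEquality : WeaklyDecidable (λ i j → fromℤ i ≈ fromℤ j)
  coefficientEquality i j with i ℤ.≟ j
  ... | yes ≡.refl = just refl
  ... | no _       = nothing

  -- Integer coefficients, so that the solver can decide equality of coefficients.
  open import Algebra.Solver.Ring ℤ.+-*-rawRing (fromCommutativeRing R) fromℤ-homomorphism
    coefficientEquality public
    using (solve; _:=_; _:+_; _:*_; _:-_; :-_)

module FiniteSums {c ℓ} (R : CommutativeRing c ℓ) where
  open RingBasics R public
  open import Algebra.Properties.Monoid.Sum +-monoid using (sum)

  Σ< : ℕ → (ℕ → Carrier) → Carrier
  Σ< zero    f = 0#
  Σ< (suc n) f = Σ< n f + f n

  Σ<-cong : ∀ n {f g} → (∀ t → t < n → f t ≈ g t) → Σ< n f ≈ Σ< n g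
  Σ<-cong zero    f≈g = refl
  Σ<-cong (suc n) f≈g = +-cong (Σ<-cong n (λ t t<n → f≈g t (ℕ.m<n⇒m<1+n t<n))) (f≈g n ℕ.≤-refl)

  Σ<-zero : ∀ n {f} → (∀ t → t < n → f t ≈ 0#) → Σ< n f ≈ 0#
  Σ<-zero zero    f≈0 = refl
  Σ<-zero (suc n) f≈0 =
    trans (+-cong (Σ<-zero n (λ t t<n → f≈0 t (ℕ.m<n⇒m<1+n t<n))) (f≈0 n ℕ.≤-refl)) (+-identityʳ 0#)

  Σ<-distrib-+ : ∀ n f g → Σ< n (λ t → f t + g t) ≈ Σ< n f + Σ< n g
  Σ<-distrib-+ zero    f g = sym (+-identityʳ 0#)
  Σ<-distrib-+ (suc n) f g = trans (+-congʳ (Σ<-distrib-+ n f g))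
    (solve 4 (λ a b c d → (a :+ b) :+ (c :+ d) := (a :+ c) :+ (b :+ d)) refl _ _ _ _)

  Σ<-distrib-- : ∀ n f g → Σ< n (λ t → f t - g t) ≈ Σ< n f - Σ< n g
  Σ<-distrib-- zero    f g = sym (-‿inverseʳ 0#)
  Σ<-distrib-- (suc n) f g = trans (+-congʳ (Σ<-distrib-- n f g))
    (solve 4 (λ a b c d → (a :- b) :+ (c :- d) := (a :+ c) :- (b :+ d)) refl _ _ _ _)

  *-distribˡ-Σ< : ∀ n x f → x * Σ< n f ≈ Σ< n (λ t → x * f t)
  *-distribˡ-Σ< zero    x f = zeroʳ x
  *-distribˡ-Σ< (suc n) x f = trans (distribˡ x _ _) (+-congʳ (*-distribˡ-Σ< n x f))

  Σ<-head : ∀ n f → Σ< (suc n) f ≈ f 0 + Σ< n (λ t → f (suc t))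
  Σ<-head zero    f = trans (+-identityˡ _) (sym (+-identityʳ _))
  Σ<-head (suc n) f = trans (+-congʳ (Σ<-head n f)) (+-assoc _ _ _)

  Σ<-comm : ∀ k l (g : ℕ → ℕ → Carrier) →
            Σ< k (λ j → Σ< l (g j)) ≈ Σ< l (λ s → Σ< k (λ j → g j s))
  Σ<-comm zero    l g = sym (Σ<-zero l (λ _ _ → refl))
  Σ<-comm (suc k) l g = trans (+-congʳ (Σ<-comm k l g)) (sym (Σ<-distrib-+ l _ _))

  Σ<-extend : ∀ {k l} f → k ≤ l → (∀ t → k ≤ t → f t ≈ 0#) → Σ< l f ≈ Σ< k f
  Σ<-extend {l = zero}  f z≤n     f≈0 = refl
  Σ<-extend {k} {suc l} f k≤1+l f≈0 with ℕ.m≤n⇒m<n∨m≡n k≤1+l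
  ... | inj₁ k<1+l  = trans (+-cong (Σ<-extend f (ℕ.≤-pred k<1+l) f≈0) (f≈0 l (ℕ.≤-pred k<1+l))) (+-identityʳ _)
  ... | inj₂ ≡.refl = refl

  sum≈Σ< : ∀ n (f : ℕ → Carrier) → sum {n} (λ i → f (toℕ i)) ≈ Σ< n f
  sum≈Σ< zero    f = refl
  sum≈Σ< (suc n) f = trans (+-congˡ (sum≈Σ< n (λ t → f (suc t)))) (sym (Σ<-head n f))

  binomial : ∀ x y m → (x + y) ^ m ≈ Σ< (suc m) (λ s → fromℕ (m C s) * (x ^ s * y ^ (m ∸ s)))
  binomial x y m = begin
    (x + y) ^ m                                                   ≈⟨ Binomial.theorem x y (*-comm x y) m ⟩
    sum {suc m} (λ i → (m C toℕ i) × (x ^ toℕ i * y ^ (m ∸ toℕ i))) ≈⟨ sum≈Σ< (suc m) _ ⟩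
    Σ< (suc m) (λ s → (m C s) × (x ^ s * y ^ (m ∸ s)))          ≈⟨ Σ<-cong (suc m) (λ s _ → fromℕ-×-* (m C s) _) ⟩
    Σ< (suc m) (λ s → fromℕ (m C s) * (x ^ s * y ^ (m ∸ s)))    ∎
    where module Binomial = Algebra.Properties.Semiring.Binomial semiring

module Differences {c ℓ} (R : CommutativeRing c ℓ) where
  open FiniteSums R public

  -- A sequence f is read as the power series Σ f k xᵏ: shift multiplies by x, ∇ by 1 - x,
  -- and Deg≤ N f says that f is a polynomial of degree at most N.
  Seq : Set c
  Seq = ℕ → Carrier

  infix 4 _≐_
  _≐_ : Seq → Seq → Set ℓ
  f ≐ g = ∀ k → f k ≈ g k

  δ : Seq
  δ zero    = 1#
  δ (suc _) = 0#

  power : ℕ → Seq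
  power s k = fromℕ (k ℕ.^ s)

  shiftedPower : ℕ → ℕ → Seq
  shiftedPower m n k = fromℕ ((n ℕ.+ k) ℕ.^ m)

  shift : Seq → Seq
  shift f zero    = 0#
  shift f (suc k) = f k

  ∇ : Seq → Seq
  ∇ f zero    = f zero
  ∇ f (suc k) = f (suc k) - f k

  ∇^ : ℕ → Seq → Seq
  ∇^ zero    f = f
  ∇^ (suc d) f = ∇ (∇^ d f)

  shift-cong : ∀ {f g} → f ≐ g → shift f ≐ shift g
  shift-cong f≐g zero    = refl
  shift-cong f≐g (suc k) = f≐g k

  ∇^-cong : ∀ d {f g} → f ≐ g → ∇^ d f ≐ ∇^ d g
  ∇^-cong zero    f≐g k       = f≐g k
  ∇^-cong (suc d) f≐g zero    = ∇^-cong d f≐g zero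
  ∇^-cong (suc d) f≐g (suc k) = +-cong (∇^-cong d f≐g (suc k)) (-‿cong (∇^-cong d f≐g k))

  ∇^-suc : ∀ d f → ∇^ (suc d) f ≐ ∇^ d (∇ f)
  ∇^-suc zero    f k = refl
  ∇^-suc (suc d) f   = ∇^-cong 1 (∇^-suc d f)

  ∇^-∇^ : ∀ a b f → ∇^ a (∇^ b f) ≐ ∇^ (a ℕ.+ b) f
  ∇^-∇^ zero    b f k = refl
  ∇^-∇^ (suc a) b f   = ∇^-cong 1 (∇^-∇^ a b f)

  ∇≐id-shift : ∀ f → ∇ f ≐ λ k → f k - shift f k
  ∇≐id-shift f zero    = sym (trans (+-congˡ -0#≈0#) (+-identityʳ _))
  ∇≐id-shift f (suc k) = refl

  ∇^-distrib-+ : ∀ d f g → ∇^ d (λ k → f k + g k) ≐ λ k → ∇^ d f k + ∇^ d g k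
  ∇^-distrib-+ zero    f g k = refl
  ∇^-distrib-+ (suc d) f g k = trans (∇^-cong 1 (∇^-distrib-+ d f g) k) (step k)
    where
    step : ∇ (λ k → ∇^ d f k + ∇^ d g k) ≐ λ k → ∇ (∇^ d f) k + ∇ (∇^ d g) k
    step zero    = refl
    step (suc k) = solve 4 (λ a b c e → (a :+ b) :- (c :+ e) := (a :- c) :+ (b :- e)) refl _ _ _ _

  ∇^-*ˡ : ∀ d x f → ∇^ d (λ k → x * f k) ≐ λ k → x * ∇^ d f k
  ∇^-*ˡ zero    x f k = refl
  ∇^-*ˡ (suc d) x f k = trans (∇^-cong 1 (∇^-*ˡ d x f) k) (step k)
    where
    step : ∇ (λ k → x * ∇^ d f k) ≐ λ k → x * ∇ (∇^ d f) k
    step zero    = refl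
    step (suc k) = sym (x[y-z]≈xy-xz x _ _)

  ∇^-Σ< : ∀ d n (G : ℕ → Seq) → ∇^ d (λ k → Σ< n (λ r → G r k)) ≐ λ k → Σ< n (λ r → ∇^ d (G r) k)
  ∇^-Σ< zero    n G k = refl
  ∇^-Σ< (suc d) n G k = trans (∇^-cong 1 (∇^-Σ< d n G) k) (step k)
    where
    step : ∇ (λ k → Σ< n (λ r → ∇^ d (G r) k)) ≐ λ k → Σ< n (λ r → ∇ (∇^ d (G r)) k)
    step zero    = refl
    step (suc k) = sym (Σ<-distrib-- n _ _)

  ∇^-shift : ∀ d f → ∇^ d (shift f) ≐ shift (∇^ d f)
  ∇^-shift zero    f k = refl
  ∇^-shift (suc d) f k = trans (∇^-cong 1 (∇^-shift d f) k) (step k)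
    where
    step : ∇ (shift (∇^ d f)) ≐ shift (∇ (∇^ d f))
    step zero          = refl
    step (suc zero)    = trans (+-congˡ -0#≈0#) (+-identityʳ _)
    step (suc (suc k)) = refl

  signedBinomial : ℕ → ℕ → Carrier
  signedBinomial d t = (- 1#) ^ t * fromℕ (d C t)

  signedBinomial-pascal : ∀ d t →
    signedBinomial (suc d) (suc t) ≈ signedBinomial d (suc t) - signedBinomial d t
  signedBinomial-pascal d t = begin
    (- 1# * σ) * fromℕ (suc d C suc t)
      ≈⟨ *-cong (-1*x≈-x σ) (reflexive (≡.cong fromℕ (≡.sym (nCk+nC[k+1]≡[n+1]C[k+1] d t)))) ⟩
    - σ * fromℕ (d C t ℕ.+ d C suc t)              ≈⟨ *-congˡ (fromℕ-+ (d C t) (d C suc t)) ⟩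
    - σ * (fromℕ (d C t) + fromℕ (d C suc t))      ≈⟨ solve 3 (λ s a b → :- s :* (a :+ b) := :- s :* b :- s :* a) refl σ _ _ ⟩
    - σ * fromℕ (d C suc t) - σ * fromℕ (d C t)    ≈⟨ +-congʳ (*-congʳ (-1*x≈-x σ)) ⟨
    (- 1# * σ) * fromℕ (d C suc t) - σ * fromℕ (d C t) ∎
    where
    σ : Carrier
    σ = (- 1#) ^ t

  ∇^-coefficients : ∀ d f k → ∇^ d f k ≈ Σ< (suc k) (λ t → signedBinomial d t * f (k ∸ t))
  ∇^-coefficients zero f k = sym (begin
    Σ< (suc k) (λ t → signedBinomial 0 t * f (k ∸ t))               ≈⟨ Σ<-head k _ ⟩
    (1# * (1# + 0#)) * f k + Σ< k (λ t → signedBinomial 0 (suc t) * f (k ∸ suc t))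
      ≈⟨ +-cong (trans (*-congʳ (trans (*-identityˡ _) (+-identityʳ 1#))) (*-identityˡ _)) (Σ<-zero k vanish) ⟩
    f k + 0#                                                          ≈⟨ +-identityʳ _ ⟩
    f k                                                               ∎)
    where
    vanish : ∀ t → t < k → signedBinomial 0 (suc t) * f (k ∸ suc t) ≈ 0#
    vanish t _ = trans (*-congʳ (zeroʳ _)) (zeroˡ _)
  ∇^-coefficients (suc d) f zero = ∇^-coefficients d f 0
  ∇^-coefficients (suc d) f (suc k) = begin
    ∇^ d f (suc k) - ∇^ d f k
      ≈⟨ +-cong (∇^-coefficients d f (suc k)) (-‿cong (∇^-coefficients d f k)) ⟩
    Σ< (suc (suc k)) (λ t → signedBinomial d t * f (suc k ∸ t)) - Σ< (suc k) (λ t → signedBinomial d t * f (k ∸ t))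
      ≈⟨ +-congʳ (Σ<-head (suc k) _) ⟩
    (σ₀ * f (suc k) + Σ< (suc k) (λ t → signedBinomial d (suc t) * f (k ∸ t))) - Σ< (suc k) (λ t → signedBinomial d t * f (k ∸ t))
      ≈⟨ trans (+-assoc _ _ _) (+-congˡ (sym (Σ<-distrib-- (suc k) _ _))) ⟩
    σ₀ * f (suc k) + Σ< (suc k) (λ t → signedBinomial d (suc t) * f (k ∸ t) - signedBinomial d t * f (k ∸ t))
      ≈⟨ +-congˡ (Σ<-cong (suc k) (λ t _ → trans (sym ([y-z]x≈yx-zx _ _ _)) (*-congʳ (sym (signedBinomial-pascal d t))))) ⟩
    σ₀ * f (suc k) + Σ< (suc k) (λ t → signedBinomial (suc d) (suc t) * f (k ∸ t))
      ≈⟨ Σ<-head (suc k) _ ⟨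
    Σ< (suc (suc k)) (λ t → signedBinomial (suc d) t * f (suc k ∸ t)) ∎
    where
    σ₀ : Carrier
    σ₀ = signedBinomial d 0

  shiftedPower-binomial : ∀ m n → shiftedPower m n
                                  ≐ λ k → Σ< (suc m) (λ s → fromℕ (m C s) * (fromℕ (n ℕ.^ (m ∸ s)) * power s k))
  shiftedPower-binomial m n k = begin
    fromℕ ((n ℕ.+ k) ℕ.^ m)           ≈⟨ fromℕ-^ (n ℕ.+ k) m ⟩
    fromℕ (n ℕ.+ k) ^ m               ≈⟨ ^-congˡ m (trans (fromℕ-+ n k) (+-comm _ _)) ⟩
    (fromℕ k + fromℕ n) ^ m           ≈⟨ binomial (fromℕ k) (fromℕ n) m ⟩
    Σ< (suc m) (λ s → fromℕ (m C s) * (fromℕ k ^ s * fromℕ n ^ (m ∸ s)))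
      ≈⟨ Σ<-cong (suc m) (λ s _ → *-congˡ (trans (*-comm _ _) (sym (*-cong (fromℕ-^ n (m ∸ s)) (fromℕ-^ k s))))) ⟩
    Σ< (suc m) (λ s → fromℕ (m C s) * (fromℕ (n ℕ.^ (m ∸ s)) * power s k)) ∎

  shiftedPower-head : ∀ m n → shiftedPower m n ≐ λ k → fromℕ (n ℕ.^ m) * δ k + shift (shiftedPower m (suc n)) k
  shiftedPower-head m n zero    = begin
    fromℕ ((n ℕ.+ 0) ℕ.^ m)    ≡⟨ ≡.cong (λ i → fromℕ (i ℕ.^ m)) (ℕ.+-identityʳ n) ⟩
    fromℕ (n ℕ.^ m)            ≈⟨ trans (+-identityʳ _) (*-identityʳ _) ⟨
    fromℕ (n ℕ.^ m) * 1# + 0#  ∎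
  shiftedPower-head m n (suc k) = begin
    fromℕ ((n ℕ.+ suc k) ℕ.^ m)                    ≡⟨ ≡.cong (λ i → fromℕ (i ℕ.^ m)) (ℕ.+-suc n k) ⟩
    fromℕ ((suc n ℕ.+ k) ℕ.^ m)                    ≈⟨ trans (+-congʳ (zeroʳ _)) (+-identityˡ _) ⟨
    fromℕ (n ℕ.^ m) * 0# + fromℕ ((suc n ℕ.+ k) ℕ.^ m) ∎

  ∇^-shiftedPower : ∀ d m n → ∇^ d (shiftedPower m n)
    ≐ λ k → Σ< (suc m) (λ s → fromℕ (m C s) * (fromℕ (n ℕ.^ (m ∸ s)) * ∇^ d (power s) k))
  ∇^-shiftedPower d m n k = begin
    ∇^ d (shiftedPower m n) k   ≈⟨ ∇^-cong d (shiftedPower-binomial m n) k ⟩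
    ∇^ d (λ j → Σ< (suc m) (λ s → fromℕ (m C s) * (fromℕ (n ℕ.^ (m ∸ s)) * power s j))) k ≈⟨ ∇^-Σ< d (suc m) _ k ⟩
    Σ< (suc m) (λ s → ∇^ d (λ j → fromℕ (m C s) * (fromℕ (n ℕ.^ (m ∸ s)) * power s j)) k)
      ≈⟨ Σ<-cong (suc m) (λ s _ → trans (∇^-*ˡ d _ _ k) (*-congˡ (∇^-*ˡ d _ _ k))) ⟩
    Σ< (suc m) (λ s → fromℕ (m C s) * (fromℕ (n ℕ.^ (m ∸ s)) * ∇^ d (power s) k)) ∎

  ∇-power : ∀ r → ∇ (power r) ≐ λ k → fromℕ (0 ℕ.^ r) * δ k + shift (λ j → Σ< r (λ s → fromℕ (r C s) * power s j)) k
  ∇-power r zero    = sym (trans (+-identityʳ _) (*-identityʳ _))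
  ∇-power r (suc k) = begin
    power r (suc k) - power r k                          ≈⟨ +-congʳ (shiftedPower-binomial r 1 k) ⟩
    (Σ< r term + term r) - power r k                     ≈⟨ +-congʳ (+-congˡ last-term) ⟩
    (Σ< r term + power r k) - power r k                  ≈⟨ solve 2 (λ a b → (a :+ b) :- b := a) refl _ _ ⟩
    Σ< r term
      ≈⟨ Σ<-cong r (λ s _ → *-congˡ (trans (*-congʳ (one^ (r ∸ s))) (*-identityˡ _))) ⟩
    Σ< r (λ s → fromℕ (r C s) * power s k)               ≈⟨ trans (+-congʳ (zeroʳ _)) (+-identityˡ _) ⟨
    fromℕ (0 ℕ.^ r) * 0# + Σ< r (λ s → fromℕ (r C s) * power s k) ∎
    where
    term : ℕ → Carrier
    term s = fromℕ (r C s) * (fromℕ (1 ℕ.^ (r ∸ s)) * power s k)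
    one^ : ∀ e → fromℕ (1 ℕ.^ e) ≈ 1#
    one^ e = trans (reflexive (≡.cong fromℕ (ℕ.^-zeroˡ e))) (+-identityʳ 1#)
    last-term : term r ≈ power r k
    last-term = begin
      fromℕ (r C r) * (fromℕ (1 ℕ.^ (r ∸ r)) * power r k)
        ≈⟨ *-cong (reflexive (≡.cong fromℕ (nCn≡1 r))) (trans (*-congʳ (one^ (r ∸ r))) (*-identityˡ _)) ⟩
      (1# + 0#) * power r k                                 ≈⟨ trans (*-congʳ (+-identityʳ 1#)) (*-identityˡ _) ⟩
      power r k                                             ∎

  ∇^-suc-power : ∀ d r → ∇^ (suc d) (power r)
    ≐ λ k → fromℕ (0 ℕ.^ r) * ∇^ d δ k + shift (λ j → Σ< r (λ s → fromℕ (r C s) * ∇^ d (power s) j)) k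
  ∇^-suc-power d r k = begin
    ∇^ (suc d) (power r) k                                    ≈⟨ ∇^-suc d (power r) k ⟩
    ∇^ d (∇ (power r)) k                                      ≈⟨ ∇^-cong d (∇-power r) k ⟩
    ∇^ d (λ j → fromℕ (0 ℕ.^ r) * δ j + shift G j) k          ≈⟨ ∇^-distrib-+ d _ _ k ⟩
    ∇^ d (λ j → fromℕ (0 ℕ.^ r) * δ j) k + ∇^ d (shift G) k   ≈⟨ +-cong (∇^-*ˡ d _ δ k) (∇^-shift d G k) ⟩
    fromℕ (0 ℕ.^ r) * ∇^ d δ k + shift (∇^ d G) k
      ≈⟨ +-congˡ (shift-cong (λ j → trans (∇^-Σ< d r _ j) (Σ<-cong r (λ s _ → ∇^-*ˡ d _ (power s) j))) k) ⟩
    fromℕ (0 ℕ.^ r) * ∇^ d δ k + shift (λ j → Σ< r (λ s → fromℕ (r C s) * ∇^ d (power s) j)) k ∎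
    where
    G : Seq
    G j = Σ< r (λ s → fromℕ (r C s) * power s j)

  Deg≤ : ℕ → Seq → Set ℓ
  Deg≤ N f = ∀ k → N < k → f k ≈ 0#

  Deg≤-cong : ∀ {N f g} → f ≐ g → Deg≤ N f → Deg≤ N g
  Deg≤-cong f≐g f≤N k N<k = trans (sym (f≐g k)) (f≤N k N<k)

  Deg≤-δ : Deg≤ 0 δ
  Deg≤-δ (suc k) _ = refl

  Deg≤-shift : ∀ {N f} → Deg≤ N f → Deg≤ (suc N) (shift f)
  Deg≤-shift f≤N (suc k) (s≤s N<k) = f≤N k N<k

  Deg≤-∇^ : ∀ d {N f} → Deg≤ N f → Deg≤ (d ℕ.+ N) (∇^ d f)
  Deg≤-∇^ zero    f≤N k       N<k         = f≤N k N<k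
  Deg≤-∇^ (suc d) f≤N (suc k) (s≤s d+N<k) =
    trans (+-cong (Deg≤-∇^ d f≤N (suc k) (ℕ.m<n⇒m<1+n d+N<k)) (-‿cong (Deg≤-∇^ d f≤N k d+N<k)))
          (trans (+-identityˡ _) -0#≈0#)

  Deg≤-*ˡ : ∀ {N f} x → Deg≤ N f → Deg≤ N (λ k → x * f k)
  Deg≤-*ˡ x f≤N k N<k = trans (*-congˡ (f≤N k N<k)) (zeroʳ x)

  Deg≤-+ : ∀ {N f g} → Deg≤ N f → Deg≤ N g → Deg≤ N (λ k → f k + g k)
  Deg≤-+ f≤N g≤N k N<k = trans (+-cong (f≤N k N<k) (g≤N k N<k)) (+-identityʳ 0#)

  Deg≤-Σ< : ∀ {N} n (G : ℕ → Seq) → (∀ r → r < n → Deg≤ N (G r)) → Deg≤ N (λ k → Σ< n (λ r → G r k))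
  Deg≤-Σ< n G G≤N k N<k = Σ<-zero n (λ r r<n → G≤N r r<n k N<k)

  Deg≤-∇^-δ : ∀ d → Deg≤ d (∇^ d δ)
  Deg≤-∇^-δ d = ≡.subst (λ N → Deg≤ N (∇^ d δ)) (ℕ.+-identityʳ d) (Deg≤-∇^ d Deg≤-δ)

  Deg≤-∇^-power : ∀ d r → r ≤ d → Deg≤ d (∇^ (suc d) (power r))
  Deg≤-∇^-power zero    zero z≤n (suc k) _ = -‿inverseʳ _
  Deg≤-∇^-power (suc d) r r≤1+d = Deg≤-cong (λ k → sym (∇^-suc-power (suc d) r k))
    (Deg≤-+ (Deg≤-*ˡ _ (Deg≤-∇^-δ (suc d)))
            (Deg≤-shift (Deg≤-Σ< r _ (λ s s<r → Deg≤-*ˡ _ (Deg≤-∇^-power d s (ℕ.≤-pred (ℕ.<-≤-trans s<r r≤1+d)))))))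

  Deg≤-∇^-shiftedPower : ∀ m n → Deg≤ m (∇^ (suc m) (shiftedPower m n))
  Deg≤-∇^-shiftedPower m n = Deg≤-cong (λ k → sym (∇^-shiftedPower (suc m) m n k))
    (Deg≤-Σ< (suc m) _ (λ s s<1+m → Deg≤-*ˡ _ (Deg≤-*ˡ _ (Deg≤-∇^-power m s (ℕ.≤-pred s<1+m)))))

  -- eulerian s j = A(s,j), by Eulerian≈eulerian below.
  eulerian : ℕ → Seq
  eulerian s = ∇^ (suc s) (power s)

  module Action (q : Carrier) (y : ℕ → Carrier) (recurrence : ∀ k → y (suc (suc k)) ≈ y (suc k) - q * y k) where
    -- The polynomial f in the shift operator applied to y, at k; L bounds the support of f.
    act : ℕ → Seq → ℕ → Carrier
    act L f k = Σ< L (λ j → f j * y (k ℕ.+ j))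

    act-cong : ∀ L {f g} k → f ≐ g → act L f k ≈ act L g k
    act-cong L k f≐g = Σ<-cong L (λ j _ → *-congʳ (f≐g j))

    act-extend : ∀ {N f} L k → Deg≤ N f → N < L → act L f k ≈ act (suc N) f k
    act-extend L k f≤N N<L = Σ<-extend _ N<L (λ j N<j → trans (*-congʳ (f≤N j N<j)) (zeroˡ _))

    act-shift : ∀ L f k → act (suc L) (shift f) k ≈ act L f (suc k)
    act-shift L f k = begin
      act (suc L) (shift f) k                             ≈⟨ Σ<-head L _ ⟩
      0# * y (k ℕ.+ 0) + Σ< L (λ j → f j * y (k ℕ.+ suc j))  ≈⟨ trans (+-congʳ (zeroˡ _)) (+-identityˡ _) ⟩
      Σ< L (λ j → f j * y (k ℕ.+ suc j))                  ≈⟨ Σ<-cong L (λ j _ → reflexive (≡.cong (λ i → f j * y i) (ℕ.+-suc k j))) ⟩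
      act L f (suc k)                                     ∎

    act-distrib-+ : ∀ L f g k → act L (λ j → f j + g j) k ≈ act L f k + act L g k
    act-distrib-+ L f g k = trans (Σ<-cong L (λ j _ → distribʳ _ _ _)) (Σ<-distrib-+ L _ _)

    act-distrib-- : ∀ L f g k → act L (λ j → f j - g j) k ≈ act L f k - act L g k
    act-distrib-- L f g k = trans (Σ<-cong L (λ j _ → [y-z]x≈yx-zx _ _ _)) (Σ<-distrib-- L _ _)

    act-*ˡ : ∀ L x f k → act L (λ j → x * f j) k ≈ x * act L f k
    act-*ˡ L x f k = trans (Σ<-cong L (λ j _ → *-assoc _ _ _)) (sym (*-distribˡ-Σ< L x _))

    act-Σ< : ∀ L n (G : ℕ → Seq) k → act L (λ j → Σ< n (λ s → G s j)) k ≈ Σ< n (λ s → act L (G s) k)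
    act-Σ< L n G k = begin
      Σ< L (λ j → Σ< n (λ s → G s j) * y (k ℕ.+ j))   ≈⟨ Σ<-cong L (λ j _ → trans (*-comm _ _) (*-distribˡ-Σ< n _ _)) ⟩
      Σ< L (λ j → Σ< n (λ s → y (k ℕ.+ j) * G s j))   ≈⟨ Σ<-comm L n _ ⟩
      Σ< n (λ s → Σ< L (λ j → y (k ℕ.+ j) * G s j))   ≈⟨ Σ<-cong n (λ s _ → Σ<-cong L (λ j _ → *-comm _ _)) ⟩
      Σ< n (λ s → act L (G s) k)                      ∎

    act-δ : ∀ L k → act (suc L) δ k ≈ y k
    act-δ L k = begin
      act (suc L) δ k                                       ≈⟨ Σ<-head L _ ⟩
      1# * y (k ℕ.+ 0) + Σ< L (λ j → 0# * y (k ℕ.+ suc j))  ≈⟨ +-cong (*-identityˡ _) (Σ<-zero L (λ _ _ → zeroˡ _)) ⟩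
      y (k ℕ.+ 0) + 0#                                      ≈⟨ +-identityʳ _ ⟩
      y (k ℕ.+ 0)                                           ≡⟨ ≡.cong y (ℕ.+-identityʳ k) ⟩
      y k                                                   ∎

    act-recurrence : ∀ L f k → act L f (suc k) - act L f (suc (suc k)) ≈ q * act L f k
    act-recurrence L f k = begin
      act L f (suc k) - act L f (suc (suc k))
        ≈⟨ trans (sym (Σ<-distrib-- L _ _)) (Σ<-cong L (λ j _ → sym (x[y-z]≈xy-xz _ _ _))) ⟩
      Σ< L (λ j → f j * (y (suc k ℕ.+ j) - y (suc (suc k) ℕ.+ j)))  ≈⟨ Σ<-cong L (λ j _ → *-congˡ (step (k ℕ.+ j))) ⟩
      Σ< L (λ j → f j * (q * y (k ℕ.+ j)))
        ≈⟨ Σ<-cong L (λ j _ → solve 3 (λ a b c → a :* (b :* c) := b :* (a :* c)) refl _ _ _) ⟩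
      Σ< L (λ j → q * (f j * y (k ℕ.+ j)))               ≈⟨ *-distribˡ-Σ< L q _ ⟨
      q * act L f k                                      ∎
      where
      step : ∀ i → y (suc i) - y (suc (suc i)) ≈ q * y i
      step i = trans (+-congˡ (-‿cong (recurrence i))) (solve 2 (λ a b → a :- (a :- b) := b) refl _ _)

    act-∇ : ∀ {N f} k → Deg≤ N f → act (suc (suc N)) (∇ f) (suc k) ≈ q * act (suc N) f k
    act-∇ {N} {f} k f≤N = begin
      act (suc (suc N)) (∇ f) (suc k)                                    ≈⟨ act-cong (suc (suc N)) (suc k) (∇≐id-shift f) ⟩
      act (suc (suc N)) (λ j → f j - shift f j) (suc k)                  ≈⟨ act-distrib-- (suc (suc N)) f (shift f) (suc k) ⟩
      act (suc (suc N)) f (suc k) - act (suc (suc N)) (shift f) (suc k)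
        ≈⟨ +-cong (act-extend (suc (suc N)) (suc k) f≤N (ℕ.m<n⇒m<1+n (ℕ.n<1+n N))) (-‿cong (act-shift (suc N) f (suc k))) ⟩
      act (suc N) f (suc k) - act (suc N) f (suc (suc k))                ≈⟨ act-recurrence (suc N) f k ⟩
      q * act (suc N) f k                                                ∎

    act-∇^ : ∀ d {N f} k → Deg≤ N f → act (suc (d ℕ.+ N)) (∇^ d f) (d ℕ.+ k) ≈ q ^ d * act (suc N) f k
    act-∇^ zero        k f≤N = sym (*-identityˡ _)
    act-∇^ (suc d) {N} {f} k f≤N = begin
      act (suc (suc (d ℕ.+ N))) (∇ (∇^ d f)) (suc (d ℕ.+ k)) ≈⟨ act-∇ (d ℕ.+ k) (Deg≤-∇^ d f≤N) ⟩
      q * act (suc (d ℕ.+ N)) (∇^ d f) (d ℕ.+ k)             ≈⟨ *-congˡ (act-∇^ d k f≤N) ⟩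
      q * (q ^ d * act (suc N) f k)                          ≈⟨ *-assoc _ _ _ ⟨
      q ^ suc d * act (suc N) f k                            ∎

    eulerianSum : ℕ → ℕ → Carrier
    eulerianSum s n = act (suc s) (eulerian s) (suc s ℕ.+ n)

    eulerianSum-0 : ∀ n → eulerianSum 0 n ≈ y (suc n)
    eulerianSum-0 n = begin
      0# + (1# + 0#) * y (suc n ℕ.+ 0)  ≈⟨ trans (+-identityˡ _) (*-congʳ (+-identityʳ 1#)) ⟩
      1# * y (suc n ℕ.+ 0)              ≈⟨ *-identityˡ _ ⟩
      y (suc n ℕ.+ 0)                   ≡⟨ ≡.cong y (ℕ.+-identityʳ (suc n)) ⟩
      y (suc n)                         ∎

    -- Formally q^{m+1} Σ_{k≥n} k^m y_k.
    remainder : ℕ → ℕ → Carrier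
    remainder m n = act (suc m) (∇^ (suc m) (shiftedPower m n)) (suc m ℕ.+ n)

    act-∇^-δ : ∀ d n → act (suc (suc d)) (∇^ (suc d) δ) (suc d ℕ.+ n) ≈ q ^ suc d * y n
    act-∇^-δ d n = begin
      act (suc (suc d)) (∇^ (suc d) δ) (suc d ℕ.+ n)
        ≡⟨ ≡.cong (λ i → act (suc i) (∇^ (suc d) δ) (suc d ℕ.+ n)) (ℕ.+-identityʳ (suc d)) ⟨
      act (suc (suc d ℕ.+ 0)) (∇^ (suc d) δ) (suc d ℕ.+ n)  ≈⟨ act-∇^ (suc d) n Deg≤-δ ⟩
      q ^ suc d * act 1 δ n                                ≈⟨ *-congˡ (act-δ 0 n) ⟩
      q ^ suc d * y n                                      ∎

    remainder-step : ∀ m n → remainder m n ≈ fromℕ (n ℕ.^ m) * (q ^ suc m * y n) + remainder m (suc n)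
    remainder-step m n = begin
      act (suc m) (∇^ (suc m) (shiftedPower m n)) (suc m ℕ.+ n)
        ≈⟨ act-extend (suc (suc m)) _ (Deg≤-∇^-shiftedPower m n) (ℕ.m<n⇒m<1+n (ℕ.n<1+n m)) ⟨
      act (suc (suc m)) (∇^ (suc m) (shiftedPower m n)) (suc m ℕ.+ n)
        ≈⟨ act-cong (suc (suc m)) _ split ⟩
      act (suc (suc m)) (λ k → fromℕ (n ℕ.^ m) * ∇^ (suc m) δ k + shift (∇^ (suc m) (shiftedPower m (suc n))) k) (suc m ℕ.+ n)
        ≈⟨ act-distrib-+ (suc (suc m)) _ _ _ ⟩
      act (suc (suc m)) (λ k → fromℕ (n ℕ.^ m) * ∇^ (suc m) δ k) (suc m ℕ.+ n)
        + act (suc (suc m)) (shift (∇^ (suc m) (shiftedPower m (suc n)))) (suc m ℕ.+ n)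
        ≈⟨ +-cong (trans (act-*ˡ (suc (suc m)) _ _ _) (*-congˡ (act-∇^-δ m n))) (act-shift (suc m) _ _) ⟩
      fromℕ (n ℕ.^ m) * (q ^ suc m * y n) + act (suc m) (∇^ (suc m) (shiftedPower m (suc n))) (suc (suc m ℕ.+ n))
        ≡⟨ ≡.cong (λ i → fromℕ (n ℕ.^ m) * (q ^ suc m * y n) + act (suc m) (∇^ (suc m) (shiftedPower m (suc n))) i)
                  (ℕ.+-suc (suc m) n) ⟨
      fromℕ (n ℕ.^ m) * (q ^ suc m * y n) + remainder m (suc n) ∎
      where
      split : ∇^ (suc m) (shiftedPower m n)
              ≐ λ k → fromℕ (n ℕ.^ m) * ∇^ (suc m) δ k + shift (∇^ (suc m) (shiftedPower m (suc n))) k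
      split k = begin
        ∇^ (suc m) (shiftedPower m n) k ≈⟨ ∇^-cong (suc m) (shiftedPower-head m n) k ⟩
        ∇^ (suc m) (λ j → fromℕ (n ℕ.^ m) * δ j + shift (shiftedPower m (suc n)) j) k ≈⟨ ∇^-distrib-+ (suc m) _ _ k ⟩
        ∇^ (suc m) (λ j → fromℕ (n ℕ.^ m) * δ j) k + ∇^ (suc m) (shift (shiftedPower m (suc n))) k
          ≈⟨ +-cong (∇^-*ˡ (suc m) _ δ k) (∇^-shift (suc m) _ k) ⟩
        fromℕ (n ℕ.^ m) * ∇^ (suc m) δ k + shift (∇^ (suc m) (shiftedPower m (suc n))) k ∎

    remainder-telescope : ∀ m n → remainder m 0 ≈ remainder m n + q ^ suc m * Σ< n (λ k → power m k * y k)
    remainder-telescope m zero    = sym (trans (+-congˡ (zeroʳ _)) (+-identityʳ _))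
    remainder-telescope m (suc n) = begin
      remainder m 0                                                ≈⟨ remainder-telescope m n ⟩
      remainder m n + Q * Σ< n g                                   ≈⟨ +-congʳ (remainder-step m n) ⟩
      (fromℕ (n ℕ.^ m) * (Q * y n) + remainder m (suc n)) + Q * Σ< n g
        ≈⟨ solve 5 (λ a Q' Y b S → (a :* (Q' :* Y) :+ b) :+ Q' :* S := b :+ Q' :* (S :+ a :* Y)) refl _ Q (y n) _ (Σ< n g) ⟩
      remainder m (suc n) + Q * Σ< (suc n) g                       ∎
      where
      Q : Carrier
      Q = q ^ suc m
      g : ℕ → Carrier
      g k = power m k * y k

    act-∇^-power : ∀ m s n → s ≤ m →
      act (suc m) (∇^ (suc m) (power s)) (suc m ℕ.+ n) ≈ q ^ (m ∸ s) * eulerianSum s n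
    act-∇^-power m s n s≤m = begin
      act (suc m) (∇^ (suc m) (power s)) (suc m ℕ.+ n)
        ≈⟨ act-cong (suc m) _ (λ k → sym (trans (∇^-∇^ (m ∸ s) (suc s) (power s) k)
                                                (reflexive (≡.cong (λ d → ∇^ d (power s) k) d≡1+m)))) ⟩
      act (suc m) (∇^ (m ∸ s) (eulerian s)) (suc m ℕ.+ n)
        ≡⟨ ≡.cong₂ (λ L k → act (suc L) (∇^ (m ∸ s) (eulerian s)) k) (ℕ.m∸n+n≡m s≤m) (≡.cong (ℕ._+ n) d≡1+m) ⟨
      act (suc (m ∸ s ℕ.+ s)) (∇^ (m ∸ s) (eulerian s)) (m ∸ s ℕ.+ suc s ℕ.+ n)
        ≡⟨ ≡.cong (act (suc (m ∸ s ℕ.+ s)) (∇^ (m ∸ s) (eulerian s))) (ℕ.+-assoc (m ∸ s) (suc s) n) ⟩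
      act (suc (m ∸ s ℕ.+ s)) (∇^ (m ∸ s) (eulerian s)) (m ∸ s ℕ.+ (suc s ℕ.+ n))
        ≈⟨ act-∇^ (m ∸ s) (suc s ℕ.+ n) (Deg≤-∇^-power s s ℕ.≤-refl) ⟩
      q ^ (m ∸ s) * eulerianSum s n ∎
      where
      d≡1+m : m ∸ s ℕ.+ suc s ≡ suc m
      d≡1+m = ≡.trans (ℕ.+-suc (m ∸ s) s) (≡.cong suc (ℕ.m∸n+n≡m s≤m))

    remainder-expansion : ∀ m n → remainder m n
      ≈ Σ< (suc m) (λ s → fromℕ (m C s) * (fromℕ (n ℕ.^ (m ∸ s)) * (q ^ (m ∸ s) * eulerianSum s n)))
    remainder-expansion m n = begin
      remainder m n  ≈⟨ act-cong (suc m) _ (∇^-shiftedPower (suc m) m n) ⟩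
      act (suc m) (λ k → Σ< (suc m) (λ s → fromℕ (m C s) * (fromℕ (n ℕ.^ (m ∸ s)) * ∇^ (suc m) (power s) k))) (suc m ℕ.+ n)
        ≈⟨ act-Σ< (suc m) (suc m) _ _ ⟩
      Σ< (suc m) (λ s → act (suc m) (λ k → fromℕ (m C s) * (fromℕ (n ℕ.^ (m ∸ s)) * ∇^ (suc m) (power s) k)) (suc m ℕ.+ n))
        ≈⟨ Σ<-cong (suc m) (λ s s<1+m → trans (act-*ˡ (suc m) _ _ _) (*-congˡ (trans (act-*ˡ (suc m) _ _ _)
                                               (*-congˡ (act-∇^-power m s n (ℕ.≤-pred s<1+m)))))) ⟩
      Σ< (suc m) (λ s → fromℕ (m C s) * (fromℕ (n ℕ.^ (m ∸ s)) * (q ^ (m ∸ s) * eulerianSum s n))) ∎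

    power-sum : ∀ {r} → q * r ≈ 1# → ∀ m n →
      Σ< n (λ k → power m k * y k)
        ≈ eulerianSum m 0 * r ^ suc m
          - Σ< (suc m) (λ s → fromℕ (m C s) * (fromℕ (n ℕ.^ (m ∸ s)) * (eulerianSum s n * r ^ suc s)))
    power-sum {r} qr≈1 m n = begin
      S                                                 ≈⟨ trans (sym (*-identityˡ S)) (*-congʳ (sym (^-inverse qr≈1 (suc m)))) ⟩
      (q ^ suc m * ρ) * S                               ≈⟨ solve 3 (λ Q ρ' S' → Q :* ρ' :* S' := ρ' :* (Q :* S')) refl _ ρ S ⟩
      ρ * (q ^ suc m * S)                               ≈⟨ *-congˡ telescoped ⟩
      ρ * (remainder m 0 - remainder m n)               ≈⟨ trans (x[y-z]≈xy-xz ρ _ _) (+-congʳ (*-comm ρ _)) ⟩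
      eulerianSum m 0 * ρ - ρ * remainder m n
        ≈⟨ +-congˡ (-‿cong (trans (*-congˡ (remainder-expansion m n)) (*-distribˡ-Σ< (suc m) ρ _))) ⟩
      eulerianSum m 0 * ρ - Σ< (suc m) (λ s → ρ * term s)
        ≈⟨ +-congˡ (-‿cong (Σ<-cong (suc m) (λ s s<1+m → rescale s (ℕ.≤-pred s<1+m)))) ⟩
      eulerianSum m 0 * ρ - Σ< (suc m) (λ s → fromℕ (m C s) * (fromℕ (n ℕ.^ (m ∸ s)) * (eulerianSum s n * r ^ suc s))) ∎
      where
      S ρ : Carrier
      S = Σ< n (λ k → power m k * y k)
      ρ = r ^ suc m
      term : ℕ → Carrier
      term s = fromℕ (m C s) * (fromℕ (n ℕ.^ (m ∸ s)) * (q ^ (m ∸ s) * eulerianSum s n))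
      telescoped : q ^ suc m * S ≈ remainder m 0 - remainder m n
      telescoped = begin
        q ^ suc m * S                                    ≈⟨ solve 2 (λ a b → b := (a :+ b) :- a) refl (remainder m n) _ ⟩
        (remainder m n + q ^ suc m * S) - remainder m n  ≈⟨ +-congʳ (remainder-telescope m n) ⟨
        remainder m 0 - remainder m n                    ∎
      rescale : ∀ s → s ≤ m → ρ * term s ≈ fromℕ (m C s) * (fromℕ (n ℕ.^ (m ∸ s)) * (eulerianSum s n * r ^ suc s))
      rescale s s≤m = begin
        ρ * term s
          ≈⟨ solve 5 (λ ρ' a b Q X → ρ' :* (a :* (b :* (Q :* X))) := a :* (b :* (X :* (Q :* ρ'))))
                   refl ρ _ _ (q ^ (m ∸ s)) (eulerianSum s n) ⟩
        fromℕ (m C s) * (fromℕ (n ℕ.^ (m ∸ s)) * (eulerianSum s n * (q ^ (m ∸ s) * ρ)))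
          ≈⟨ *-congˡ (*-congˡ (*-congˡ (^-cancel qr≈1 (s≤s s≤m)))) ⟩
        fromℕ (m C s) * (fromℕ (n ℕ.^ (m ∸ s)) * (eulerianSum s n * r ^ suc s)) ∎

module CharZeroField {c ℓ} (F : Char0Field c ℓ) where
  open Char0Field F using (commutativeRing; _⁻¹; ⁻¹-inverse; char0)
  open Differences commutativeRing public
  module FD = FieldDefs F
  open FD public using (w*; u; v; pow; _÷_; δ₀; Σ[_⋯_])

  two : Carrier
  two = 1# + 1#

  1#≉0# : ¬ (1# ≈ 0#)
  1#≉0# 1≈0 = char0 0 (trans (+-identityʳ 1#) 1≈0)

  two≉0# : ¬ (two ≈ 0#)
  two≉0# 2≈0 = char0 1 (trans (+-congˡ (+-identityʳ 1#)) 2≈0)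

  ⁻¹-unique : ∀ {x z} → x * z ≈ 1# → x ⁻¹ ≈ z
  ⁻¹-unique {x} {z} xz≈1 = begin
    x ⁻¹               ≈⟨ *-identityʳ _ ⟨
    x ⁻¹ * 1#          ≈⟨ *-congˡ xz≈1 ⟨
    x ⁻¹ * (x * z)     ≈⟨ *-assoc _ _ _ ⟨
    (x ⁻¹ * x) * z     ≈⟨ *-congʳ (trans (*-comm _ _) (⁻¹-inverse x x≉0)) ⟩
    1# * z             ≈⟨ *-identityˡ z ⟩
    z                  ∎
    where
    x≉0 : ¬ (x ≈ 0#)
    x≉0 x≈0 = 1#≉0# (trans (sym xz≈1) (trans (*-congʳ x≈0) (zeroˡ z)))

  pow≡^ : ∀ x k → pow x k ≡ x ^ k
  pow≡^ x zero    = ≡.refl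
  pow≡^ x (suc k) = ≡.cong (x *_) (pow≡^ x k)

  Σ[0⋯]≈Σ< : ∀ hi f → Σ[ 0 ⋯ hi ] f ≈ Σ< (suc hi) f
  Σ[0⋯]≈Σ< zero     f = refl
  Σ[0⋯]≈Σ< (suc hi) f = +-congʳ (Σ[0⋯]≈Σ< hi f)

  Σ[1⋯]≈Σ< : ∀ hi f → Σ[ 1 ⋯ hi ] f ≈ Σ< hi (λ k → f (suc k))
  Σ[1⋯]≈Σ< zero     f = refl
  Σ[1⋯]≈Σ< (suc hi) f = +-congʳ (Σ[1⋯]≈Σ< hi f)

  fromℤ-sumℤ≤ : ∀ g j → fromℤ (sumℤ≤ g j) ≈ Σ< (suc j) (λ t → fromℤ (g t))
  fromℤ-sumℤ≤ g zero    = sym (+-identityˡ _)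
  fromℤ-sumℤ≤ g (suc j) = trans (fromℤ-+ (sumℤ≤ g j) (g (suc j))) (+-congʳ (fromℤ-sumℤ≤ g j))

  Eulerian≈eulerian : ∀ i j → FD.fromℤ (Eulerian i j) ≈ eulerian i j
  Eulerian≈eulerian i j = begin
    FD.fromℤ (Eulerian i j)  ≡⟨ FD-fromℤ≡fromℤ (Eulerian i j) ⟩
    fromℤ (Eulerian i j)     ≈⟨ fromℤ-sumℤ≤ _ j ⟩
    Σ< (suc j) (λ t → fromℤ ((ℤ.- ℤ.1ℤ) ℤ.^ t ℤ.* + (suc i C t) ℤ.* + ((j ∸ t) ℕ.^ i)))
      ≈⟨ Σ<-cong (suc j) (λ t _ → term t) ⟩
    Σ< (suc j) (λ t → signedBinomial (suc i) t * power i (j ∸ t)) ≈⟨ ∇^-coefficients (suc i) (power i) j ⟨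
    eulerian i j             ∎
    where
    FD-fromℤ≡fromℤ : ∀ z → FD.fromℤ z ≡ fromℤ z
    FD-fromℤ≡fromℤ (+ n)    = ≡.refl
    FD-fromℤ≡fromℤ -[1+ n ] = ≡.refl
    minus-one^ : ∀ t → fromℤ ((ℤ.- ℤ.1ℤ) ℤ.^ t) ≈ (- 1#) ^ t
    minus-one^ t = trans (fromℤ-^ (ℤ.- ℤ.1ℤ) t) (^-congˡ t (-‿cong (+-identityʳ 1#)))
    term : ∀ t → fromℤ ((ℤ.- ℤ.1ℤ) ℤ.^ t ℤ.* + (suc i C t) ℤ.* + ((j ∸ t) ℕ.^ i)) ≈ signedBinomial (suc i) t * power i (j ∸ t)
    term t = trans (fromℤ-* ((ℤ.- ℤ.1ℤ) ℤ.^ t ℤ.* + (suc i C t)) _)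
                   (*-congʳ (trans (fromℤ-* ((ℤ.- ℤ.1ℤ) ℤ.^ t) _) (*-congʳ (minus-one^ t))))

  eulerian-at-0 : ∀ s → eulerian (suc s) 0 ≈ 0#
  eulerian-at-0 s = trans (∇^-coefficients (suc (suc s)) (power (suc s)) 0) (trans (+-identityˡ _) (zeroʳ _))

  Σ[0⋯]-Eulerian : ∀ s (G : ℕ → Carrier) →
    Σ[ 0 ⋯ s ] (λ j → FD.fromℤ (Eulerian s j) * G j) ≈ Σ< (suc s) (λ j → eulerian s j * G j)
  Σ[0⋯]-Eulerian s G = trans (Σ[0⋯]≈Σ< s (λ j → FD.fromℤ (Eulerian s j) * G j))
                             (Σ<-cong (suc s) (λ j _ → *-congʳ (Eulerian≈eulerian s j)))

  Σ[1⋯]-Eulerian : ∀ s (G : ℕ → Carrier) → Σ[ 1 ⋯ suc s ] (λ j → FD.fromℤ (Eulerian (suc s) j) * G j)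
                          ≈ Σ< (suc (suc s)) (λ j → eulerian (suc s) j * G j)
  Σ[1⋯]-Eulerian s G = begin
    Σ[ 1 ⋯ suc s ] (λ j → FD.fromℤ (Eulerian (suc s) j) * G j)
      ≈⟨ trans (Σ[1⋯]≈Σ< (suc s) (λ j → FD.fromℤ (Eulerian (suc s) j) * G j))
               (Σ<-cong (suc s) (λ j _ → *-congʳ (Eulerian≈eulerian (suc s) (suc j)))) ⟩
    Σ< (suc s) (λ j → eulerian (suc s) (suc j) * G (suc j))
      ≈⟨ trans (+-congʳ (trans (*-congʳ (eulerian-at-0 s)) (zeroˡ _))) (+-identityˡ _) ⟨
    eulerian (suc s) 0 * G 0 + Σ< (suc s) (λ j → eulerian (suc s) (suc j) * G (suc j))
      ≈⟨ Σ<-head (suc s) _ ⟨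
    Σ< (suc (suc s)) (λ j → eulerian (suc s) j * G j) ∎

  module WithSequence (a b q : Carrier) (q≉0 : ¬ (q ≈ 0#)) where
    W : ℤ → Carrier
    W = w* a b q

    y : ℕ → Carrier
    y k = W (+ k)

    D : ℕ → Carrier
    D j = W (+ j ℤ.+ ℤ.1ℤ) - q * W (+ j ℤ.- ℤ.1ℤ)

    A : ℕ → ℕ → Carrier
    A i j = FD.fromℤ (Eulerian i j)

    r : Carrier
    r = q ⁻¹

    qr≈1 : q * r ≈ 1#
    qr≈1 = ⁻¹-inverse q q≉0

    open Action q y (λ k → refl) public

    lucas : ∀ K j → two * y (K ℕ.+ j) ≈ v q (+ K) * y j + u q (+ K) * D j
    lucas zero          j       = sym (trans (+-congˡ (zeroˡ _)) (+-identityʳ _))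
    lucas (suc zero)    zero    = begin
      two * b
        ≈⟨ solve 3 (λ o a' b' → (o :+ o) :* b' := o :* a' :+ o :* (b' :- (a' :- b'))) refl 1# a b ⟩
      1# * a + 1# * (b - (a - b))                 ≈⟨ +-congˡ (*-congˡ (+-congˡ (-‿cong (sym cancel)))) ⟩
      1# * a + 1# * (b - q * ((a - b) ÷ q))        ∎
      where
      cancel : q * ((a - b) * r) ≈ a - b
      cancel = trans (solve 3 (λ q' x r' → q' :* (x :* r') := x :* (q' :* r')) refl q (a - b) r)
                     (trans (*-congˡ qr≈1) (*-identityʳ _))
    lucas (suc zero)    (suc j) = begin
      two * (y (suc j) - q * y j)
        ≈⟨ solve 4 (λ o y₁ q' y₀ → (o :+ o) :* (y₁ :- q' :* y₀) := o :* y₁ :+ o :* ((y₁ :- q' :* y₀) :- q' :* y₀))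
                   refl 1# (y (suc j)) q (y j) ⟩
      1# * y (suc j) + 1# * (y (suc (suc j)) - q * y j)
        ≡⟨ ≡.cong (λ i → 1# * y (suc j) + 1# * (y i - q * y j)) (ℕ.+-comm (suc j) 1) ⟨
      1# * y (suc j) + 1# * D (suc j) ∎
    lucas (suc (suc K)) j       = begin
      two * (y (suc (K ℕ.+ j)) - q * y (K ℕ.+ j))
        ≈⟨ solve 4 (λ t y₁ q' y₀ → t :* (y₁ :- q' :* y₀) := t :* y₁ :- q' :* (t :* y₀)) refl two _ q _ ⟩
      two * y (suc K ℕ.+ j) - q * (two * y (K ℕ.+ j))
        ≈⟨ +-cong (lucas (suc K) j) (-‿cong (*-congˡ (lucas K j))) ⟩
      (v q (+ suc K) * y j + u q (+ suc K) * D j) - q * (v q (+ K) * y j + u q (+ K) * D j)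
        ≈⟨ solve 7 (λ v₁ yj u₁ d q' v₀ u₀ → (v₁ :* yj :+ u₁ :* d) :- q' :* (v₀ :* yj :+ u₀ :* d)
                                           := (v₁ :- q' :* v₀) :* yj :+ (u₁ :- q' :* u₀) :* d)
                 refl (v q (+ suc K)) (y j) (u q (+ suc K)) (D j) q (v q (+ K)) (u q (+ K)) ⟩
      v q (+ suc (suc K)) * y j + u q (+ suc (suc K)) * D j ∎

    lucas-Σ : ∀ K L (cf : ℕ → Carrier) → v q (+ K) * Σ< L (λ j → cf j * y j) + u q (+ K) * Σ< L (λ j → cf j * D j)
                          ≈ two * Σ< L (λ j → cf j * y (K ℕ.+ j))
    lucas-Σ K L cf = begin
      v q (+ K) * Σ< L (λ j → cf j * y j) + u q (+ K) * Σ< L (λ j → cf j * D j)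
        ≈⟨ +-cong (*-distribˡ-Σ< L _ _) (*-distribˡ-Σ< L _ _) ⟩
      Σ< L (λ j → v q (+ K) * (cf j * y j)) + Σ< L (λ j → u q (+ K) * (cf j * D j))
        ≈⟨ Σ<-distrib-+ L _ _ ⟨
      Σ< L (λ j → v q (+ K) * (cf j * y j) + u q (+ K) * (cf j * D j))
        ≈⟨ Σ<-cong L (λ j _ → termwise j) ⟩
      Σ< L (λ j → two * (cf j * y (K ℕ.+ j)))
        ≈⟨ *-distribˡ-Σ< L two _ ⟨
      two * Σ< L (λ j → cf j * y (K ℕ.+ j)) ∎
      where
      termwise : ∀ j → v q (+ K) * (cf j * y j) + u q (+ K) * (cf j * D j) ≈ two * (cf j * y (K ℕ.+ j))
      termwise j = begin
        v q (+ K) * (cf j * y j) + u q (+ K) * (cf j * D j)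
          ≈⟨ solve 5 (λ v' c y' u' d → v' :* (c :* y') :+ u' :* (c :* d) := c :* (v' :* y' :+ u' :* d))
                     refl (v q (+ K)) (cf j) (y j) (u q (+ K)) (D j) ⟩
        cf j * (v q (+ K) * y j + u q (+ K) * D j)  ≈⟨ *-congˡ (lucas K j) ⟨
        cf j * (two * y (K ℕ.+ j))
          ≈⟨ solve 3 (λ c t y' → c :* (t :* y') := t :* (c :* y')) refl (cf j) two (y (K ℕ.+ j)) ⟩
        two * (cf j * y (K ℕ.+ j))                  ∎

    two*[two*q^k]⁻¹≈r^k : ∀ k → two * (two * pow q k) ⁻¹ ≈ r ^ k
    two*[two*q^k]⁻¹≈r^k k = begin
      two * (two * pow q k) ⁻¹     ≈⟨ *-congˡ (⁻¹-unique inverse) ⟩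
      two * (two ⁻¹ * r ^ k)       ≈⟨ *-assoc _ _ _ ⟨
      (two * two ⁻¹) * r ^ k       ≈⟨ trans (*-congʳ (⁻¹-inverse two two≉0#)) (*-identityˡ _) ⟩
      r ^ k                        ∎
      where
      inverse : (two * pow q k) * (two ⁻¹ * r ^ k) ≈ 1#
      inverse = begin
        (two * pow q k) * (two ⁻¹ * r ^ k)  ≈⟨ *-interchange _ _ _ _ ⟩
        (two * two ⁻¹) * (pow q k * r ^ k)  ≡⟨ ≡.cong (λ x → (two * two ⁻¹) * (x * r ^ k)) (pow≡^ q k) ⟩
        (two * two ⁻¹) * (q ^ k * r ^ k)    ≈⟨ *-cong (⁻¹-inverse two two≉0#) (^-inverse qr≈1 k) ⟩
        1# * 1#                             ≈⟨ *-identityˡ 1# ⟩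
        1#                                  ∎

    vCoefficient uCoefficient : ℕ → ℕ → Carrier
    vCoefficient K s = v q (+ K) ÷ (two * pow q (s ℕ.+ 1))
    uCoefficient K s = u q (+ K) ÷ (two * pow q (s ℕ.+ 1))

    eulerianW eulerianD : ℕ → ℕ → Carrier
    eulerianW lo s = Σ[ lo ⋯ s ] (λ j → A s j * W (+ j))
    eulerianD lo s = Σ[ lo ⋯ s ] (λ j → A s j * D j)

    lucas-eulerian : ∀ s n →
      vCoefficient (n ℕ.+ s ℕ.+ 1) s * eulerianW 0 s + uCoefficient (n ℕ.+ s ℕ.+ 1) s * eulerianD 0 s
        ≈ eulerianSum s n * r ^ suc s
    lucas-eulerian s n = begin
      (v q (+ K) * i) * eulerianW 0 s + (u q (+ K) * i) * eulerianD 0 s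
        ≈⟨ +-cong (*-congˡ (Σ[0⋯]-Eulerian s y)) (*-congˡ (Σ[0⋯]-Eulerian s D)) ⟩
      (v q (+ K) * i) * ΣW + (u q (+ K) * i) * ΣD
        ≈⟨ solve 5 (λ v' i' w u' d → v' :* i' :* w :+ u' :* i' :* d := (v' :* w :+ u' :* d) :* i')
                   refl (v q (+ K)) i ΣW (u q (+ K)) ΣD ⟩
      (v q (+ K) * ΣW + u q (+ K) * ΣD) * i
        ≈⟨ *-congʳ (lucas-Σ K (suc s) (eulerian s)) ⟩
      (two * Σ< (suc s) (λ j → eulerian s j * y (K ℕ.+ j))) * i
        ≈⟨ trans (*-congʳ (*-comm _ _)) (*-assoc _ _ _) ⟩
      Σ< (suc s) (λ j → eulerian s j * y (K ℕ.+ j)) * (two * i)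
        ≈⟨ *-cong (Σ<-cong (suc s) (λ j _ → reflexive (≡.cong (λ k → eulerian s j * y (k ℕ.+ j)) K≡1+s+n)))
                  (trans (two*[two*q^k]⁻¹≈r^k (s ℕ.+ 1)) (^-congʳ r (ℕ.+-comm s 1))) ⟩
      eulerianSum s n * r ^ suc s ∎
      where
      K : ℕ
      K = n ℕ.+ s ℕ.+ 1
      i ΣW ΣD : Carrier
      i = (two * pow q (s ℕ.+ 1)) ⁻¹
      ΣW = Σ< (suc s) (λ j → eulerian s j * y j)
      ΣD = Σ< (suc s) (λ j → eulerian s j * D j)
      K≡1+s+n : K ≡ suc s ℕ.+ n
      K≡1+s+n = ≡.trans (ℕ.+-comm (n ℕ.+ s) 1) (≡.cong suc (ℕ.+-comm n s))

    correction-terms : ∀ m n →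
      Σ[ 1 ⋯ m ] (λ s → fromℕ (n ℕ.^ (m ∸ s)) * fromℕ (m C s) * vCoefficient (n ℕ.+ s ℕ.+ 1) s * eulerianW 1 s)
      + Σ[ 1 ⋯ m ] (λ s → fromℕ (n ℕ.^ (m ∸ s)) * fromℕ (m C s) * uCoefficient (n ℕ.+ s ℕ.+ 1) s * eulerianD 1 s)
        ≈ Σ< m (λ s → fromℕ (m C suc s) * (fromℕ (n ℕ.^ (m ∸ suc s)) * (eulerianSum (suc s) n * r ^ suc (suc s))))
    correction-terms m n = trans (+-cong (Σ[1⋯]≈Σ< m _) (Σ[1⋯]≈Σ< m _))
                                 (trans (sym (Σ<-distrib-+ m _ _)) (Σ<-cong m (λ s _ → termwise s)))
      where
      termwise : ∀ s →
        fromℕ (n ℕ.^ (m ∸ suc s)) * fromℕ (m C suc s) * vCoefficient (n ℕ.+ suc s ℕ.+ 1) (suc s) * eulerianW 1 (suc s)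
        + fromℕ (n ℕ.^ (m ∸ suc s)) * fromℕ (m C suc s) * uCoefficient (n ℕ.+ suc s ℕ.+ 1) (suc s) * eulerianD 1 (suc s)
          ≈ fromℕ (m C suc s) * (fromℕ (n ℕ.^ (m ∸ suc s)) * (eulerianSum (suc s) n * r ^ suc (suc s)))
      termwise s = begin
        (ν * κ) * vc * eulerianW 1 (suc s) + (ν * κ) * uc * eulerianD 1 (suc s)
          ≈⟨ solve 5 (λ p v' w u' d → p :* v' :* w :+ p :* u' :* d := p :* (v' :* w :+ u' :* d)) refl (ν * κ) vc _ uc _ ⟩
        (ν * κ) * (vc * eulerianW 1 (suc s) + uc * eulerianD 1 (suc s))
          ≈⟨ *-congˡ (+-cong (*-congˡ (trans (Σ[1⋯]-Eulerian s y) (sym (Σ[0⋯]-Eulerian (suc s) y))))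
                             (*-congˡ (trans (Σ[1⋯]-Eulerian s D) (sym (Σ[0⋯]-Eulerian (suc s) D))))) ⟩
        (ν * κ) * (vc * eulerianW 0 (suc s) + uc * eulerianD 0 (suc s))
          ≈⟨ *-congˡ (lucas-eulerian (suc s) n) ⟩
        (ν * κ) * (eulerianSum (suc s) n * r ^ suc (suc s))
          ≈⟨ solve 3 (λ a c x → a :* c :* x := c :* (a :* x)) refl ν κ _ ⟩
        κ * (ν * (eulerianSum (suc s) n * r ^ suc (suc s))) ∎
        where
        ν κ vc uc : Carrier
        ν = fromℕ (n ℕ.^ (m ∸ suc s))
        κ = fromℕ (m C suc s)
        vc = vCoefficient (n ℕ.+ suc s ℕ.+ 1) (suc s)
        uc = uCoefficient (n ℕ.+ suc s ℕ.+ 1) (suc s)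

    -- The right-hand side is the s = 0 summand of power-sum minus n^m y_n.
    boundary-term : ∀ m n →
      fromℕ (n ℕ.^ m) * (W (+ (n ℕ.+ 2)) ÷ q)
        ≈ fromℕ (m C 0) * (fromℕ (n ℕ.^ (m ∸ 0)) * (eulerianSum 0 n * r ^ 1)) - fromℕ (n ℕ.^ m) * y n
    boundary-term m n = begin
      ν * (y (n ℕ.+ 2) * r)                  ≡⟨ ≡.cong (λ k → ν * (y k * r)) (ℕ.+-comm n 2) ⟩
      ν * ((y (suc n) - q * y n) * r)
        ≈⟨ solve 5 (λ ν' y₁ q' y₀ r' → ν' :* ((y₁ :- q' :* y₀) :* r') := ν' :* (y₁ :* r') :- ν' :* y₀ :* (q' :* r'))
                   refl ν (y (suc n)) q (y n) r ⟩
      ν * (y (suc n) * r) - ν * y n * (q * r)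
        ≈⟨ +-cong (*-congˡ (*-congʳ (sym (eulerianSum-0 n)))) (-‿cong (trans (*-congˡ qr≈1) (*-identityʳ _))) ⟩
      ν * (eulerianSum 0 n * r) - ν * y n
        ≈⟨ +-congʳ (trans (*-congʳ (+-identityʳ 1#)) (trans (*-identityˡ _) (*-congˡ (*-congˡ (*-identityʳ r))))) ⟨
      (1# + 0#) * (ν * (eulerianSum 0 n * (r * 1#))) - ν * y n ∎
      where
      ν : Carrier
      ν = fromℕ (n ℕ.^ m)

    Σ[1⋯n]-reindex : ∀ m n →
      Σ[ 1 ⋯ n ] (λ k → fromℕ (k ℕ.^ m) * W (+ k)) ≈ (Σ< n (λ k → power m k * y k) + fromℕ (n ℕ.^ m) * y n) - δ₀ m * a
    Σ[1⋯n]-reindex m n = begin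
      Σ[ 1 ⋯ n ] g                          ≈⟨ Σ[1⋯]≈Σ< n g ⟩
      Σ< n (λ k → g (suc k))                ≈⟨ solve 2 (λ x z → x := (z :+ x) :- z) refl _ (g 0) ⟩
      (g 0 + Σ< n (λ k → g (suc k))) - g 0  ≈⟨ +-cong (Σ<-head n g) (-‿cong (sym (g0≈δ₀a m))) ⟨
      Σ< (suc n) g - δ₀ m * a               ∎
      where
      g : ℕ → Carrier
      g k = power m k * y k
      g0≈δ₀a : ∀ m → power m 0 * a ≈ δ₀ m * a
      g0≈δ₀a zero    = *-congʳ (+-identityʳ 1#)
      g0≈δ₀a (suc m) = refl

theorem4 : ∀ {c ℓ} (F : Char0Field c ℓ) →
  let open Char0Field F
      open FieldDefs F
  in (a b q : Carrier) → ¬ (q ≈ 0#) → (m n : ℕ) →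
  let W : ℤ → Carrier
      W = w* a b q
      two = 1# + 1#
      A : ℕ → ℕ → Carrier
      A i j = fromℤ (Eulerian i j)
      -- w*_{j+1} - q w*_{j-1}
      D : ℕ → Carrier
      D j = W (+ j ℤ.+ ℤ.1ℤ) - q * W (+ j ℤ.- ℤ.1ℤ)
  in Σ[ 1 ⋯ n ] (λ k → fromℕ (k ℕ.^ m) * W (+ k))
     ≈
     ((((( - (δ₀ m * a))
     - (fromℕ (n ℕ.^ m) * (W (+ (n ℕ.+ 2)) ÷ q)))
     + ((v q (+ (m ℕ.+ 1)) ÷ (two * pow q (m ℕ.+ 1))) * Σ[ 0 ⋯ m ] (λ j → A m j * W (+ j))))
     + ((u q (+ (m ℕ.+ 1)) ÷ (two * pow q (m ℕ.+ 1))) * Σ[ 0 ⋯ m ] (λ j → A m j * D j)))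
     - Σ[ 1 ⋯ m ] (λ s → fromℕ (n ℕ.^ (m ∸ s)) * fromℕ (m C s)
                          * (v q (+ (n ℕ.+ s ℕ.+ 1)) ÷ (two * pow q (s ℕ.+ 1)))
                          * Σ[ 1 ⋯ s ] (λ j → A s j * W (+ j))))
     - Σ[ 1 ⋯ m ] (λ s → fromℕ (n ℕ.^ (m ∸ s)) * fromℕ (m C s)
                          * (u q (+ (n ℕ.+ s ℕ.+ 1)) ÷ (two * pow q (s ℕ.+ 1)))
                          * Σ[ 1 ⋯ s ] (λ j → A s j * D j))
theorem4 F a b q q≉0 m n = begin
  Σ[ 1 ⋯ n ] (λ k → fromℕ (k ℕ.^ m) * W (+ k))
    ≈⟨ Σ[1⋯n]-reindex m n ⟩
  (S + ν * y n) - E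
    ≈⟨ +-congʳ (+-congʳ (trans (power-sum qr≈1 m n) (+-congˡ (-‿cong (Σ<-head m _))))) ⟩
  ((Xρ - (t₀ + U)) + ν * y n) - E
    ≈⟨ solve 5 (λ x t u z e → ((x :- (t :+ u)) :+ z) :- e := ((:- e :- (t :- z)) :+ x) :- u) refl Xρ t₀ U (ν * y n) E ⟩
  ((- E - (t₀ - ν * y n)) + Xρ) - U
    ≈⟨ +-cong (+-cong (+-congˡ (-‿cong (boundary-term m n))) (lucas-eulerian m 0)) (-‿cong (correction-terms m n)) ⟨
  ((- E - T₂) + (T₃ᵥ + T₃ᵤ)) - (T₄ + T₅)
    ≈⟨ solve 6 (λ e t₂ t₃ t₃′ t₄ t₅ → ((:- e :- t₂) :+ (t₃ :+ t₃′)) :- (t₄ :+ t₅) := ((((:- e :- t₂) :+ t₃) :+ t₃′) :- t₄) :- t₅)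
             refl E T₂ T₃ᵥ T₃ᵤ T₄ T₅ ⟩
  ((((- E - T₂) + T₃ᵥ) + T₃ᵤ) - T₄) - T₅ ∎
  where
  open CharZeroField F
  open WithSequence a b q q≉0
  E S ν Xρ t₀ U T₂ T₃ᵥ T₃ᵤ T₄ T₅ : Carrier
  E   = δ₀ m * a
  S   = Σ< n (λ k → power m k * y k)
  ν   = fromℕ (n ℕ.^ m)
  Xρ  = eulerianSum m 0 * r ^ suc m
  t₀  = fromℕ (m C 0) * (fromℕ (n ℕ.^ (m ∸ 0)) * (eulerianSum 0 n * r ^ 1))
  U   = Σ< m (λ s → fromℕ (m C suc s) * (fromℕ (n ℕ.^ (m ∸ suc s)) * (eulerianSum (suc s) n * r ^ suc (suc s))))
  T₂  = ν * (W (+ (n ℕ.+ 2)) ÷ q)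
  T₃ᵥ = vCoefficient (m ℕ.+ 1) m * eulerianW 0 m
  T₃ᵤ = uCoefficient (m ℕ.+ 1) m * eulerianD 0 m
  T₄  = Σ[ 1 ⋯ m ] (λ s → fromℕ (n ℕ.^ (m ∸ s)) * fromℕ (m C s) * vCoefficient (n ℕ.+ s ℕ.+ 1) s * eulerianW 1 s)
  T₅  = Σ[ 1 ⋯ m ] (λ s → fromℕ (n ℕ.^ (m ∸ s)) * fromℕ (m C s) * uCoefficient (n ℕ.+ s ℕ.+ 1) s * eulerianD 1 s)
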